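{- Let $G=(V,E)$ be a DAG with $|V|=n$, source $s$ and sink $t$, such that every vertex lies on a directed path from $s$ to $t$. Consider the polyhedron $P\subseteq\mathbb{R}^V$ given by $y_v\ge y_u$ for all $uv\in E$, $y_t=1$, $y_s=0$. Let $y$ be a vertex of $P$ and let $A$ be a set of $n$ linearly independent constraints of $P$ that are active (hold with equality) at $y$. Let $G_a$ be the graph with vertex set $V$ whose edges are those $e\in E$ whose constraint belongs to $A$. Then $G_a$ consists of two (undirected) trees $T_1\ni s$ and $T_2\ni t$ with $V(T_1)\cup V(T_2)=V$ and $V(T_1)\cap V(T_2)=\emptyset$.
   Context: Every vertex of $P$ satisfies $y_s=0$ and $y_t=1$ with equality, and these are among the active constraints.
   Formalization: The vertex y of P is taken in ℚ^V rather than ℝ^V, and linear independence of the active constraints in A is taken over ℚ. -}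

module Defs where

open import Data.Nat using (ℕ; zero; suc)
open import Data.Fin using (Fin; zero; suc; _≟_)
open import Data.Bool using (Bool; if_then_else_)
open import Data.Product using (_×_; _,_; proj₁; proj₂; Σ; ∃)
open import Data.List using (List; []; _∷_)
open import Data.List.Relation.Unary.Unique.Propositional using (Unique)
open import Data.Rational using (ℚ; 0ℚ; 1ℚ; _+_; _*_; _-_; _≤_)
open import Data.Empty using (⊥)
open import Relation.Nullary using (¬_; does)
open import Relation.Binary.PropositionalEquality using (_≡_; _≢_)
open import Function.Definitions using (Injective)

-- A directed graph on vertex set Fin n with m edges; edge e goes from
-- proj₁ (E e) (tail u) to proj₂ (E e) (head v), i.e. e = uv.
Edges : ℕ → ℕ → Set
Edges n m = Fin m → Fin n × Fin n

tl : ∀ {n m} → Edges n m → Fin m → Fin n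
tl E e = proj₁ (E e)

hd : ∀ {n m} → Edges n m → Fin m → Fin n
hd E e = proj₂ (E e)

data DWalk {n m} (E : Edges n m) : Fin n → Fin n → Set where
  []  : ∀ {v} → DWalk E v v
  _∷_ : ∀ {w} (e : Fin m) → DWalk E (hd E e) w → DWalk E (tl E e) w

Acyclic : ∀ {n m} → Edges n m → Set
Acyclic {n} {m} E = (e : Fin m) → ¬ DWalk E (hd E e) (tl E e)

record STDag (n m : ℕ) (E : Edges n m) (s t : Fin n) : Set where
  field
    simple    : Injective _≡_ _≡_ E
    noLoop    : (e : Fin m) → tl E e ≢ hd E e
    acyclic   : Acyclic E
    source    : (e : Fin m) → hd E e ≢ s
    sink      : (e : Fin m) → tl E e ≢ t
    onPath    : (v : Fin n) → DWalk E s v × DWalk E v t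

-- constraints of P: one per edge (y_v ≥ y_u), plus y_s = 0 and y_t = 1
data Constraint (m : ℕ) : Set where
  edgeC : Fin m → Constraint m
  srcC  : Constraint m
  sinkC : Constraint m

δ : ∀ {n} → Fin n → Fin n → ℚ
δ a w = if does (a ≟ w) then 1ℚ else 0ℚ

row : ∀ {n m} → Edges n m → Fin n → Fin n → Constraint m → Fin n → ℚ
row E s t (edgeC e) w = δ (hd E e) w - δ (tl E e) w
row E s t srcC      w = δ s w
row E s t sinkC     w = δ t w

sumℚ : ∀ {k} → (Fin k → ℚ) → ℚ
sumℚ {zero}  f = 0ℚ
sumℚ {suc k} f = f zero + sumℚ (λ i → f (suc i))

InP : ∀ {n m} → Edges n m → Fin n → Fin n → (Fin n → ℚ) → Set
InP {n} {m} E s t y = ((e : Fin m) → y (tl E e) ≤ y (hd E e)) × (y s ≡ 0ℚ) × (y t ≡ 1ℚ)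

Active : ∀ {n m} → Edges n m → Fin n → Fin n → (Fin n → ℚ) → Constraint m → Set
Active E s t y (edgeC e) = y (tl E e) ≡ y (hd E e)
Active E s t y srcC      = y s ≡ 0ℚ
Active E s t y sinkC     = y t ≡ 1ℚ

LinIndep : ∀ {n m k} → Edges n m → Fin n → Fin n → (Fin k → Constraint m) → Set
LinIndep {n} {m} {k} E s t a =
  (c : Fin k → ℚ) → ((w : Fin n) → sumℚ (λ i → c i * row E s t (a i) w) ≡ 0ℚ) →
  (i : Fin k) → c i ≡ 0ℚ

InGa : ∀ {m k} → (Fin k → Constraint m) → Fin m → Set
InGa {m} {k} a e = Σ (Fin k) λ i → a i ≡ edgeC e

data UWalk {n m k} (E : Edges n m) (a : Fin k → Constraint m) :
           Fin n → Fin n → List (Fin m) → Set where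
  []  : ∀ {v} → UWalk E a v v []
  fwd : ∀ {w es} (e : Fin m) → InGa a e → UWalk E a (hd E e) w es → UWalk E a (tl E e) w (e ∷ es)
  bwd : ∀ {w es} (e : Fin m) → InGa a e → UWalk E a (tl E e) w es → UWalk E a (hd E e) w (e ∷ es)

Forest : ∀ {n m k} → Edges n m → (Fin k → Constraint m) → Set
Forest {n} {m} E a = (v : Fin n) (e : Fin m) (es : List (Fin m)) →
  UWalk E a v v (e ∷ es) → ¬ Unique (e ∷ es)

-- G_a consists of two trees T₁ ∋ s and T₂ ∋ t partitioning V:
-- side v = false means v ∈ T₁, side v = true means v ∈ T₂.
TwoTrees : ∀ {n m k} → Edges n m → Fin n → Fin n → (Fin k → Constraint m) → Set
TwoTrees {n} {m} E s t a = Σ (Fin n → Bool) λ side →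
  (side s ≡ Bool.false) × (side t ≡ Bool.true) ×
  ((e : Fin m) → InGa a e → side (tl E e) ≡ side (hd E e)) ×
  ((u v : Fin n) → side u ≡ side v → ∃ λ es → UWalk E a u v es) ×
  Forest E a
  where import Data.Bool as Bool

{-# OPTIONS --safe #-}
module Submission where

-- Traversing a walk of G_a and adding the row of each edge passed forwards, subtracting it for
-- each edge passed backwards, telescopes to δ_end − δ_start.  For a closed walk with distinct
-- edges this is a vanishing combination of the rows of A in which the first edge has
-- coefficient ±1, so independence makes G_a a forest.  If the component C of a vertex
-- contained neither s nor t, the indicator vector of C would be orthogonal to every row of A
-- (an edge of G_a has both ends in C or both outside, and the rows of y_s, y_t only see s, t),
-- which is impossible for n independent vectors of ℚⁿ; so every vertex is joined to s or to t.
-- Finally y is constant along G_a, its edge constraints being tight, while y_s = 0 ≠ 1 = y_t: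
-- the two trees are {y = 0} and {y = 1}.

open import Defs
open import Algebra.Bundles using (CommutativeRing)
open import Data.Bool using (Bool; true; false; if_then_else_)
open import Data.Fin using (Fin; zero; suc; punchIn; punchOut; _≟_)
open import Data.Fin.Properties using (punchInᵢ≢i; punchIn-punchOut; any?)
open import Data.Fin.Subset using (Subset; _∈_; _∉_; ⁅_⁆; _∪_; ∣_∣)
open import Data.Fin.Subset.Properties
  using (_∈?_; x∈⁅x⁆; x∈⁅y⁆⇒x≡y; ∣p∣≤n; p⊂q⇒∣p∣<∣q∣; p⊆p∪q; x∈p∪q⁺; x∈p∪q⁻)
open import Data.List using (_++_; []; _∷_)
open import Data.List.Relation.Unary.All using (All; []; _∷_)
open import Data.List.Relation.Unary.AllPairs using (_∷_)
open import Data.Nat as ℕ using (ℕ; zero; suc; _≤_)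
open import Data.Nat.Properties using (m≤m+n; <⇒≱; ≤-trans; +-suc; +-monoʳ-≤; module ≤-Reasoning)
open import Data.Product using (∃; ∃₂; _×_; _,_)
open import Data.Rational as ℚ using (ℚ; 0ℚ; 1ℚ; _+_; _*_; _-_; -_; 1/_)
import Data.Rational.Properties as ℚ
open import Data.Rational.Solver using (module +-*-Solver)
open import Data.Sum using (_⊎_; inj₁; inj₂)
open import Data.Vec.Functional using (Vector; tail; removeAt; insertAt)
open import Data.Vec.Functional.Properties using (insertAt-lookup; insertAt-punchIn)
open import Function using (_∘_)
open import Function.Definitions using (Injective)
open import Relation.Nullary using (¬_; ¬?; yes; no; does; contradiction)
open import Relation.Nullary.Decidable as Dec
  using (Dec; decidable-stable; dec-true; dec-false; _×-dec_; _⊎-dec_)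
open import Relation.Binary.PropositionalEquality

open import Algebra.Properties.Semiring.Sum (CommutativeRing.semiring ℚ.+-*-commutativeRing)
  using ( sum; sum-syntax; sum-cong-≗; sum-replicate-zero; sum-remove; ∑-comm; ∑-distrib-+
        ; *-distribˡ-sum; *-distribʳ-sum)

open +-*-Solver

sumℚ≡sum : ∀ {k} (f : Vector ℚ k) → sumℚ f ≡ sum f
sumℚ≡sum {zero}  f = refl
sumℚ≡sum {suc k} f = cong (f zero +_) (sumℚ≡sum (f ∘ suc))

sum-zero : ∀ {k} {f : Vector ℚ k} → (∀ i → f i ≡ 0ℚ) → sum f ≡ 0ℚ
sum-zero {k} f≡0 = trans (sum-cong-≗ f≡0) (sum-replicate-zero k)

sum-concentrated : ∀ {k} (f : Vector ℚ k) (i : Fin k) → (∀ j → j ≢ i → f j ≡ 0ℚ) → sum f ≡ f i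
sum-concentrated {suc k} f i vanish = begin
  sum f                     ≡⟨ sum-remove f ⟩
  f i + sum (removeAt f i)  ≡⟨ cong (f i +_) (sum-zero vanish′) ⟩
  f i + 0ℚ                  ≡⟨ ℚ.+-identityʳ (f i) ⟩
  f i                       ∎
  where
  open ≡-Reasoning
  vanish′ : ∀ j → f (punchIn i j) ≡ 0ℚ
  vanish′ j = vanish (punchIn i j) (punchInᵢ≢i i j)

∑-distrib-− : ∀ {k} (f g : Vector ℚ k) → ∑[ i < k ] (f i - g i) ≡ sum f - sum g
∑-distrib-− {zero}  f g = refl
∑-distrib-− {suc k} f g = begin
  (f zero - g zero) + ∑[ i < k ] (f (suc i) - g (suc i))
    ≡⟨ cong ((f zero - g zero) +_) (∑-distrib-− (f ∘ suc) (g ∘ suc)) ⟩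
  (f zero - g zero) + (sum (f ∘ suc) - sum (g ∘ suc))
    ≡⟨ solve 4 (λ a b c d → (a :- b) :+ (c :- d) := (a :+ c) :- (b :+ d)) refl
               (f zero) (g zero) (sum (f ∘ suc)) (sum (g ∘ suc)) ⟩
  (f zero + sum (f ∘ suc)) - (g zero + sum (g ∘ suc))
    ∎
  where open ≡-Reasoning

δ-refl : ∀ {n} (v : Fin n) → δ v v ≡ 1ℚ
δ-refl v with v ≟ v
... | yes _  = refl
... | no v≢v = contradiction refl v≢v

δ-≢ : ∀ {n} {v w : Fin n} → v ≢ w → δ v w ≡ 0ℚ
δ-≢ {v = v} {w} v≢w with v ≟ w
... | yes v≡w = contradiction v≡w v≢w
... | no _    = refl

1≢0 : 1ℚ ≢ 0ℚ
1≢0 ()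

q≡0⇒p*q≡0 : ∀ p {q} → q ≡ 0ℚ → p * q ≡ 0ℚ
q≡0⇒p*q≡0 p refl = ℚ.*-zeroʳ p

p≡0⇒p*q≡0 : ∀ {p} q → p ≡ 0ℚ → p * q ≡ 0ℚ
p≡0⇒p*q≡0 q refl = ℚ.*-zeroˡ q

p*q≡0⇒q≡0 : ∀ {p q} → p ≢ 0ℚ → p * q ≡ 0ℚ → q ≡ 0ℚ
p*q≡0⇒q≡0 {p} {q} p≢0 pq≡0 = begin
  q               ≡⟨ ℚ.*-identityˡ q ⟨
  1ℚ * q          ≡⟨ cong (_* q) (ℚ.*-inverseˡ p) ⟨
  (1/ p * p) * q  ≡⟨ ℚ.*-assoc (1/ p) p q ⟩
  1/ p * (p * q)  ≡⟨ cong (1/ p *_) pq≡0 ⟩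
  1/ p * 0ℚ       ≡⟨ ℚ.*-zeroʳ (1/ p) ⟩
  0ℚ              ∎
  where
  open ≡-Reasoning
  instance _ = ℚ.≢-nonZero p≢0

lincomb : ∀ {k l} → Vector ℚ k → (Fin k → Vector ℚ l) → Vector ℚ l
lincomb {k} c v x = ∑[ i < k ] (c i * v i x)

_·_ : ∀ {l} → Vector ℚ l → Vector ℚ l → ℚ
_·_ {l} z y = ∑[ w < l ] (z w * y w)

lincomb-+ : ∀ {k l} (c d : Vector ℚ k) (v : Fin k → Vector ℚ l) x →
            lincomb (λ i → c i + d i) v x ≡ lincomb c v x + lincomb d v x
lincomb-+ c d v x = trans (sum-cong-≗ (λ i → ℚ.*-distribʳ-+ (v i x) (c i) (d i)))
                          (∑-distrib-+ (λ i → c i * v i x) (λ i → d i * v i x))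

lincomb-− : ∀ {k l} (c d : Vector ℚ k) (v : Fin k → Vector ℚ l) x →
            lincomb (λ i → c i - d i) v x ≡ lincomb c v x - lincomb d v x
lincomb-− c d v x =
  trans (sum-cong-≗ (λ i → solve 3 (λ c d v → (c :- d) :* v := c :* v :- d :* v)
                                   refl (c i) (d i) (v i x)))
        (∑-distrib-− (λ i → c i * v i x) (λ i → d i * v i x))

·-lincomb : ∀ {k l} (z : Vector ℚ l) (c : Vector ℚ k) (v : Fin k → Vector ℚ l) →
            z · lincomb c v ≡ ∑[ i < k ] (c i * (z · v i))
·-lincomb {k} {l} z c v = begin
  ∑[ w < l ] (z w * ∑[ i < k ] (c i * v i w))
    ≡⟨ sum-cong-≗ (λ w → *-distribˡ-sum (z w) (λ i → c i * v i w)) ⟩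
  ∑[ w < l ] ∑[ i < k ] (z w * (c i * v i w))
    ≡⟨ ∑-comm (λ w i → z w * (c i * v i w)) ⟩
  ∑[ i < k ] ∑[ w < l ] (z w * (c i * v i w))
    ≡⟨ sum-cong-≗ (λ i → sum-cong-≗ (λ w →
         solve 3 (λ z c v → z :* (c :* v) := c :* (z :* v)) refl (z w) (c i) (v i w))) ⟩
  ∑[ i < k ] ∑[ w < l ] (c i * (z w * v i w))
    ≡⟨ sum-cong-≗ (λ i → *-distribˡ-sum (c i) (λ w → z w * v i w)) ⟨
  ∑[ i < k ] (c i * (z · v i))
    ∎
  where open ≡-Reasoning

·-δ : ∀ {n} (z : Vector ℚ n) v → z · δ v ≡ z v
·-δ z v = begin
  z · δ v      ≡⟨ sum-concentrated (λ w → z w * δ v w) v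
                    (λ w w≢v → q≡0⇒p*q≡0 (z w) (δ-≢ (w≢v ∘ sym))) ⟩
  z v * δ v v  ≡⟨ cong (z v *_) (δ-refl v) ⟩
  z v * 1ℚ     ≡⟨ ℚ.*-identityʳ (z v) ⟩
  z v          ∎
  where open ≡-Reasoning

LinearlyDependent : ∀ {k l} → (Fin k → Vector ℚ l) → Set
LinearlyDependent v = ∃ λ c → (∀ x → lincomb c v x ≡ 0ℚ) × ∃ λ i → c i ≢ 0ℚ

LinearlyIndependent : ∀ {k l} → (Fin k → Vector ℚ l) → Set
LinearlyIndependent v = ∀ c → (∀ x → lincomb c v x ≡ 0ℚ) → ∀ i → c i ≡ 0ℚ

independent⇒¬dependent : ∀ {k l} {v : Fin k → Vector ℚ l} →
                         LinearlyIndependent v → ¬ LinearlyDependent v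
independent⇒¬dependent indep (c , c·v≡0 , i , cᵢ≢0) = cᵢ≢0 (indep c c·v≡0 i)

LinIndep⇒independent : ∀ {n m k} (E : Edges n m) s t (a : Fin k → Constraint m) →
                       LinIndep E s t a → LinearlyIndependent (row E s t ∘ a)
LinIndep⇒independent E s t a indep c c·v≡0 =
  indep c (λ x → trans (sumℚ≡sum (λ i → c i * row E s t (a i) x)) (c·v≡0 x))

eliminate : ∀ {k l} → (Fin (suc k) → Vector ℚ l) → Fin (suc k) → Vector ℚ k → Fin k → Vector ℚ l
eliminate v i μ j x = v (punchIn i j) x - μ j * v i x

lincomb-eliminate : ∀ {k l} (v : Fin (suc k) → Vector ℚ l) i μ (d : Vector ℚ k) x →
                    lincomb d (eliminate v i μ) x ≡ lincomb (insertAt d i (- (d · μ))) v x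
lincomb-eliminate {k} v i μ d x = begin
  ∑[ j < k ] (d j * (v′ j x - μ j * vᵢ))
    ≡⟨ sum-cong-≗ (λ j → solve 4 (λ d v μ w → d :* (v :- μ :* w) := d :* v :- (d :* μ) :* w)
                                   refl (d j) (v′ j x) (μ j) vᵢ) ⟩
  ∑[ j < k ] (d j * v′ j x - (d j * μ j) * vᵢ)
    ≡⟨ ∑-distrib-− (λ j → d j * v′ j x) (λ j → (d j * μ j) * vᵢ) ⟩
  lincomb d v′ x - ∑[ j < k ] ((d j * μ j) * vᵢ)
    ≡⟨ cong (λ r → lincomb d v′ x - r) (*-distribʳ-sum vᵢ (λ j → d j * μ j)) ⟨
  lincomb d v′ x - (d · μ) * vᵢ
    ≡⟨ solve 3 (λ s p w → s :- p :* w := (:- p) :* w :+ s) refl (lincomb d v′ x) (d · μ) vᵢ ⟩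
  (- (d · μ)) * vᵢ + lincomb d v′ x
    ≡⟨ cong₂ _+_ (cong (_* vᵢ) (insertAt-lookup d i _))
                 (sum-cong-≗ (λ j → cong (_* v′ j x) (insertAt-punchIn d i _ j))) ⟨
  c i * vᵢ + lincomb (removeAt c i) v′ x
    ≡⟨ sum-remove (λ j → c j * v j x) ⟨
  lincomb c v x
    ∎
  where
  open ≡-Reasoning
  c = insertAt d i (- (d · μ))
  v′ = removeAt v i
  vᵢ = v i x

eliminate-dependent : ∀ {k l} (v : Fin (suc k) → Vector ℚ l) i μ →
                      LinearlyDependent (eliminate v i μ) → LinearlyDependent v
eliminate-dependent v i μ (d , d·w≡0 , j , dⱼ≢0) =
  insertAt d i (- (d · μ)) ,
  (λ x → trans (sym (lincomb-eliminate v i μ d x)) (d·w≡0 x)) ,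
  punchIn i j , dⱼ≢0 ∘ trans (sym (insertAt-punchIn d i _ j))

tails-dependent : ∀ {k l} (v : Fin k → Vector ℚ (suc l)) → (∀ i → v i zero ≡ 0ℚ) →
                  LinearlyDependent (tail ∘ v) → LinearlyDependent v
tails-dependent v column≡0 (c , c·tail≡0 , nonzero) = c , c·v≡0 , nonzero
  where
  c·v≡0 : ∀ x → lincomb c v x ≡ 0ℚ
  c·v≡0 zero    = sum-zero (λ i → q≡0⇒p*q≡0 (c i) (column≡0 i))
  c·v≡0 (suc x) = c·tail≡0 x

pivot : ∀ {k l} (v : Fin (suc k) → Vector ℚ (suc l)) →
        ∃₂ λ i μ → ∀ j → v (punchIn i j) zero ≡ μ j * v i zero
pivot v with any? (λ i → ¬? (v i zero ℚ.≟ 0ℚ))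
... | yes (i , p≢0) = i , (λ j → v (punchIn i j) zero * 1/ p) , multiple
  where
  p = v i zero
  instance _ = ℚ.≢-nonZero p≢0
  multiple : ∀ j → v (punchIn i j) zero ≡ v (punchIn i j) zero * 1/ p * p
  multiple j = begin
    q               ≡⟨ ℚ.*-identityʳ q ⟨
    q * 1ℚ          ≡⟨ cong (q *_) (ℚ.*-inverseˡ p) ⟨
    q * (1/ p * p)  ≡⟨ ℚ.*-assoc q (1/ p) p ⟨
    q * 1/ p * p    ∎
    where
    open ≡-Reasoning
    q = v (punchIn i j) zero
... | no none = zero , (λ _ → 0ℚ) , λ j → trans (column≡0 (suc j)) (sym (ℚ.*-zeroˡ (v zero zero)))
  where
  column≡0 : ∀ i → v i zero ≡ 0ℚ
  column≡0 i = decidable-stable (v i zero ℚ.≟ 0ℚ) (λ vᵢ≢0 → none (i , vᵢ≢0))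

suc-vectors-dependent : ∀ {l} (v : Fin (suc l) → Vector ℚ l) → LinearlyDependent v
suc-vectors-dependent {zero}  v = (λ _ → 1ℚ) , (λ ()) , zero , 1≢0
suc-vectors-dependent {suc l} v with pivot v
... | i , μ , multiple =
  eliminate-dependent v i μ (tails-dependent w eliminated (suc-vectors-dependent (tail ∘ w)))
  where
  w = eliminate v i μ
  eliminated : ∀ j → w j zero ≡ 0ℚ
  eliminated j = trans (cong (_- μ j * v i zero) (multiple j)) (ℚ.+-inverseʳ (μ j * v i zero))

-- Dropping coordinate u leaves n vectors in ℚⁿ⁻¹; their combination S vanishes off u, and
-- z · S = Σ cᵢ (z · vᵢ) = 0 reduces to z_u S_u = 0.
orthogonal-dependent : ∀ {n} (v : Fin n → Vector ℚ n) (z : Vector ℚ n) (u : Fin n) →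
                       z u ≢ 0ℚ → (∀ i → z · v i ≡ 0ℚ) → LinearlyDependent v
orthogonal-dependent {suc k} v z u zᵤ≢0 z⊥v with suc-vectors-dependent (λ i → removeAt (v i) u)
... | c , c·v′≡0 , nonzero = c , S≡0 , nonzero
  where
  S = lincomb c v
  off-u : ∀ w → w ≢ u → S w ≡ 0ℚ
  off-u w w≢u = subst (λ w → S w ≡ 0ℚ) (punchIn-punchOut u≢w) (c·v′≡0 (punchOut u≢w))
    where u≢w = w≢u ∘ sym
  zᵤSᵤ≡0 : z u * S u ≡ 0ℚ
  zᵤSᵤ≡0 = begin
    z u * S u                         ≡⟨ sum-concentrated (λ w → z w * S w) u
                                           (λ w w≢u → q≡0⇒p*q≡0 (z w) (off-u w w≢u)) ⟨
    z · S                             ≡⟨ ·-lincomb z c v ⟩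
    ∑[ i < suc k ] (c i * (z · v i))  ≡⟨ sum-zero (λ i → q≡0⇒p*q≡0 (c i) (z⊥v i)) ⟩
    0ℚ                                ∎
    where open ≡-Reasoning
  S≡0 : ∀ w → S w ≡ 0ℚ
  S≡0 w with w ≟ u
  ... | yes refl = p*q≡0⇒q≡0 zᵤ≢0 zᵤSᵤ≡0
  ... | no w≢u   = off-u w w≢u

∣p∣<∣p∪⁅w⁆∣ : ∀ {n} {p : Subset n} {w} → w ∉ p → ∣ p ∣ ℕ.< ∣ p ∪ ⁅ w ⁆ ∣
∣p∣<∣p∪⁅w⁆∣ {p = p} {w} w∉p = p⊂q⇒∣p∣<∣q∣ (p⊆p∪q ⁅ w ⁆ , w , x∈p∪q⁺ (inj₂ (x∈⁅x⁆ w)) , w∉p)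

indicator : ∀ {n} → Subset n → Vector ℚ n
indicator p w = if does (w ∈? p) then 1ℚ else 0ℚ

indicator-∈ : ∀ {n} {p : Subset n} {w} → w ∈ p → indicator p w ≡ 1ℚ
indicator-∈ {p = p} {w} w∈p = cong (if_then 1ℚ else 0ℚ) (dec-true (w ∈? p) w∈p)

indicator-∉ : ∀ {n} {p : Subset n} {w} → w ∉ p → indicator p w ≡ 0ℚ
indicator-∉ {p = p} {w} w∉p = cong (if_then 1ℚ else 0ℚ) (dec-false (w ∈? p) w∉p)

module ConstraintGraph {n m k} (E : Edges n m) (a : Fin k → Constraint m) where

  Connected : Fin n → Fin n → Set
  Connected u v = ∃ (UWalk E a u v)

  _++ʷ_ : ∀ {u v w es fs} → UWalk E a u v es → UWalk E a v w fs → UWalk E a u w (es ++ fs)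
  []          ++ʷ q = q
  fwd e e∈ p ++ʷ q = fwd e e∈ (p ++ʷ q)
  bwd e e∈ p ++ʷ q = bwd e e∈ (p ++ʷ q)

  connected-trans : ∀ {u v w} → Connected u v → Connected v w → Connected u w
  connected-trans (_ , p) (_ , q) = _ , p ++ʷ q

  connected-sym : ∀ {u v} → Connected u v → Connected v u
  connected-sym (_ , [])         = _ , []
  connected-sym (_ , fwd e e∈ p) = connected-trans (connected-sym (_ , p)) (_ , bwd e e∈ [])
  connected-sym (_ , bwd e e∈ p) = connected-trans (connected-sym (_ , p)) (_ , fwd e e∈ [])

  constant-on-connected : ∀ {A : Set} (f : Fin n → A) → (∀ e → InGa a e → f (tl E e) ≡ f (hd E e)) →
                          ∀ {u v} → Connected u v → f u ≡ f v
  constant-on-connected f f-edge (_ , [])         = refl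
  constant-on-connected f f-edge (_ , fwd e e∈ p) =
    trans (f-edge e e∈) (constant-on-connected f f-edge (_ , p))
  constant-on-connected f f-edge (_ , bwd e e∈ p) =
    trans (sym (f-edge e e∈)) (constant-on-connected f f-edge (_ , p))

  equal-values-connected : ∀ {A : Set} {s t} (f : Fin n → A) →
                           (∀ e → InGa a e → f (tl E e) ≡ f (hd E e)) → f s ≢ f t →
                           (∀ u → Connected u s ⊎ Connected u t) →
                           ∀ u v → f u ≡ f v → Connected u v
  equal-values-connected {s = s} {t} f f-edge fₛ≢fₜ reach u v fᵤ≡fᵥ with reach u | reach v
  ... | inj₁ u~s | inj₁ v~s = connected-trans u~s (connected-sym v~s)
  ... | inj₂ u~t | inj₂ v~t = connected-trans u~t (connected-sym v~t)
  ... | inj₁ u~s | inj₂ v~t = contradiction (begin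
    f s  ≡⟨ constant-on-connected f f-edge (connected-sym u~s) ⟩
    f u  ≡⟨ fᵤ≡fᵥ ⟩
    f v  ≡⟨ constant-on-connected f f-edge v~t ⟩
    f t  ∎) fₛ≢fₜ
    where open ≡-Reasoning
  ... | inj₂ u~t | inj₁ v~s = contradiction (begin
    f s  ≡⟨ constant-on-connected f f-edge (connected-sym v~s) ⟩
    f v  ≡⟨ fᵤ≡fᵥ ⟨
    f u  ≡⟨ constant-on-connected f f-edge u~t ⟩
    f t  ∎) fₛ≢fₜ
    where open ≡-Reasoning

  Leaving : Subset n → Fin m → Set
  Leaving p e = (tl E e ∈ p × hd E e ∉ p) ⊎ (hd E e ∈ p × tl E e ∉ p)

  leaving? : ∀ p e → Dec (Leaving p e)
  leaving? p e = (tl E e ∈? p ×-dec ¬? (hd E e ∈? p)) ⊎-dec (hd E e ∈? p ×-dec ¬? (tl E e ∈? p))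

  LeavingConstraint : Subset n → Constraint m → Set
  LeavingConstraint p c = ∃ λ e → c ≡ edgeC e × Leaving p e

  leavingConstraint? : ∀ p c → Dec (LeavingConstraint p c)
  leavingConstraint? p (edgeC e) =
    Dec.map′ (λ l → e , refl , l) (λ { (_ , refl , l) → l }) (leaving? p e)
  leavingConstraint? p srcC  = no λ { (_ , () , _) }
  leavingConstraint? p sinkC = no λ { (_ , () , _) }

  indicator-¬Leaving : ∀ {p e} → ¬ Leaving p e → indicator p (tl E e) ≡ indicator p (hd E e)
  indicator-¬Leaving {p} {e} ¬leaving with tl E e ∈? p | hd E e ∈? p
  ... | yes _    | yes _    = refl
  ... | no  _    | no  _    = refl
  ... | yes tl∈p | no  hd∉p = contradiction (inj₁ (tl∈p , hd∉p)) ¬leaving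
  ... | no  tl∉p | yes hd∈p = contradiction (inj₂ (hd∈p , tl∉p)) ¬leaving

  Reaches : Fin n → Subset n → Set
  Reaches u p = ∀ {w} → w ∈ p → Connected u w

  step-out : ∀ {u p e} → Reaches u p → InGa a e → Leaving p e → ∃ λ w → w ∉ p × Connected u w
  step-out {e = e} reach e∈ (inj₁ (tl∈p , hd∉p)) =
    hd E e , hd∉p , connected-trans (reach tl∈p) (_ , fwd e e∈ [])
  step-out {e = e} reach e∈ (inj₂ (hd∈p , tl∉p)) =
    tl E e , tl∉p , connected-trans (reach hd∈p) (_ , bwd e e∈ [])

  record Component (u : Fin n) : Set where
    field
      members   : Subset n
      u∈members : u ∈ members
      connected : Reaches u members
      closed    : ∀ e → InGa a e → ¬ Leaving members e

  component : ∀ u → Component u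
  component u = grow n ⁅ u ⁆ (x∈⁅x⁆ u) reach₀ (m≤m+n n _)
    where
    reach₀ : Reaches u ⁅ u ⁆
    reach₀ w∈⁅u⁆ = subst (Connected u) (sym (x∈⁅y⁆⇒x≡y u w∈⁅u⁆)) (_ , [])
    grow : ∀ fuel p → u ∈ p → Reaches u p → n ≤ fuel ℕ.+ ∣ p ∣ → Component u
    grow fuel p u∈p reach bound with any? (λ i → leavingConstraint? p (a i))
    ... | no none = record
      { members = p ; u∈members = u∈p ; connected = reach
      ; closed = λ e (i , aᵢ≡e) l → none (i , e , aᵢ≡e , l) }
    ... | yes (i , e , aᵢ≡e , l) with step-out reach (i , aᵢ≡e) l
    grow zero p u∈p reach bound | yes _ | w , w∉p , _ =
      contradiction bound (<⇒≱ (≤-trans (∣p∣<∣p∪⁅w⁆∣ w∉p) (∣p∣≤n (p ∪ ⁅ w ⁆))))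
    grow (suc fuel) p u∈p reach bound | yes _ | w , w∉p , u~w =
      grow fuel (p ∪ ⁅ w ⁆) (x∈p∪q⁺ (inj₁ u∈p)) reach′ bound′
      where
      reach′ : Reaches u (p ∪ ⁅ w ⁆)
      reach′ x∈ with x∈p∪q⁻ p ⁅ w ⁆ x∈
      ... | inj₁ x∈p   = reach x∈p
      ... | inj₂ x∈⁅w⁆ = subst (Connected u) (sym (x∈⁅y⁆⇒x≡y w x∈⁅w⁆)) u~w
      bound′ : n ≤ fuel ℕ.+ ∣ p ∪ ⁅ w ⁆ ∣
      bound′ = begin
        n                       ≤⟨ bound ⟩
        suc fuel ℕ.+ ∣ p ∣       ≡⟨ +-suc fuel ∣ p ∣ ⟨
        fuel ℕ.+ suc ∣ p ∣       ≤⟨ +-monoʳ-≤ fuel (∣p∣<∣p∪⁅w⁆∣ w∉p) ⟩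
        fuel ℕ.+ ∣ p ∪ ⁅ w ⁆ ∣   ∎
        where open ≤-Reasoning

edgeIndicator : ∀ {m} → Fin m → Constraint m → ℚ
edgeIndicator e (edgeC f) = δ e f
edgeIndicator e srcC      = 0ℚ
edgeIndicator e sinkC     = 0ℚ

edgeIndicator-≢ : ∀ {m} {e : Fin m} c → c ≢ edgeC e → edgeIndicator e c ≡ 0ℚ
edgeIndicator-≢ (edgeC f) c≢e = δ-≢ (c≢e ∘ cong edgeC ∘ sym)
edgeIndicator-≢ srcC      c≢e = refl
edgeIndicator-≢ sinkC     c≢e = refl

lincomb-edgeIndicator : ∀ {m k l} {a : Fin k → Constraint m} {e} → Injective _≡_ _≡_ a → InGa a e →
                        (r : Constraint m → Vector ℚ l) →
                        ∀ x → lincomb (edgeIndicator e ∘ a) (r ∘ a) x ≡ r (edgeC e) x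
lincomb-edgeIndicator {a = a} {e} inj (i , aᵢ≡e) r x = begin
  lincomb (edgeIndicator e ∘ a) (r ∘ a) x  ≡⟨ sum-concentrated _ i off-i ⟩
  edgeIndicator e (a i) * r (a i) x        ≡⟨ cong (λ c → edgeIndicator e c * r c x) aᵢ≡e ⟩
  δ e e * r (edgeC e) x                    ≡⟨ cong (_* r (edgeC e) x) (δ-refl e) ⟩
  1ℚ * r (edgeC e) x                       ≡⟨ ℚ.*-identityˡ (r (edgeC e) x) ⟩
  r (edgeC e) x                            ∎
  where
  open ≡-Reasoning
  off-i : ∀ j → j ≢ i → edgeIndicator e (a j) * r (a j) x ≡ 0ℚ
  off-i j j≢i = p≡0⇒p*q≡0 (r (a j) x) (edgeIndicator-≢ (a j) aⱼ≢e)
    where aⱼ≢e = λ aⱼ≡e → j≢i (inj (trans aⱼ≡e (sym aᵢ≡e)))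

module ConstraintRows {n m k} (E : Edges n m) (s t : Fin n) (a : Fin k → Constraint m) where

  open ConstraintGraph E a

  rows : Fin k → Vector ℚ n
  rows i = row E s t (a i)

  walkCoefficient : ∀ {u v es} → UWalk E a u v es → Constraint m → ℚ
  walkCoefficient []          c = 0ℚ
  walkCoefficient (fwd e _ p) c = edgeIndicator e c + walkCoefficient p c
  walkCoefficient (bwd e _ p) c = walkCoefficient p c - edgeIndicator e c

  lincomb-walk : Injective _≡_ _≡_ a → ∀ {u v es} (p : UWalk E a u v es) x →
                 lincomb (walkCoefficient p ∘ a) rows x ≡ δ v x - δ u x
  lincomb-walk inj {u} [] x =
    trans (sum-zero (λ i → ℚ.*-zeroˡ (rows i x))) (sym (ℚ.+-inverseʳ (δ u x)))
  lincomb-walk inj {v = v} (fwd e e∈ p) x = begin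
    lincomb (λ i → edgeIndicator e (a i) + walkCoefficient p (a i)) rows x
      ≡⟨ lincomb-+ (edgeIndicator e ∘ a) (walkCoefficient p ∘ a) rows x ⟩
    lincomb (edgeIndicator e ∘ a) rows x + lincomb (walkCoefficient p ∘ a) rows x
      ≡⟨ cong₂ _+_ (lincomb-edgeIndicator inj e∈ (row E s t) x) (lincomb-walk inj p x) ⟩
    (δ (hd E e) x - δ (tl E e) x) + (δ v x - δ (hd E e) x)
      ≡⟨ solve 3 (λ h t v → (h :- t) :+ (v :- h) := v :- t)
                 refl (δ (hd E e) x) (δ (tl E e) x) (δ v x) ⟩
    δ v x - δ (tl E e) x
      ∎
    where open ≡-Reasoning
  lincomb-walk inj {v = v} (bwd e e∈ p) x = begin
    lincomb (λ i → walkCoefficient p (a i) - edgeIndicator e (a i)) rows x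
      ≡⟨ lincomb-− (walkCoefficient p ∘ a) (edgeIndicator e ∘ a) rows x ⟩
    lincomb (walkCoefficient p ∘ a) rows x - lincomb (edgeIndicator e ∘ a) rows x
      ≡⟨ cong₂ _-_ (lincomb-walk inj p x) (lincomb-edgeIndicator inj e∈ (row E s t) x) ⟩
    (δ v x - δ (tl E e) x) - (δ (hd E e) x - δ (tl E e) x)
      ≡⟨ solve 3 (λ h t v → (v :- t) :- (h :- t) := v :- h)
                 refl (δ (hd E e) x) (δ (tl E e) x) (δ v x) ⟩
    δ v x - δ (hd E e) x
      ∎
    where open ≡-Reasoning

  walkCoefficient-∉ : ∀ {u v e es} (p : UWalk E a u v es) → All (e ≢_) es →
                      walkCoefficient p (edgeC e) ≡ 0ℚ
  walkCoefficient-∉ []          []           = refl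
  walkCoefficient-∉ (fwd f _ p) (e≢f ∷ e∉es) =
    trans (cong₂ _+_ (δ-≢ (e≢f ∘ sym)) (walkCoefficient-∉ p e∉es)) (ℚ.+-identityʳ 0ℚ)
  walkCoefficient-∉ (bwd f _ p) (e≢f ∷ e∉es) =
    trans (cong₂ _-_ (walkCoefficient-∉ p e∉es) (δ-≢ (e≢f ∘ sym))) (ℚ.+-inverseʳ 0ℚ)

  first-edge-coefficient : ∀ {u v e es} (p : UWalk E a u v (e ∷ es)) → All (e ≢_) es →
                           walkCoefficient p (edgeC e) ≢ 0ℚ
  first-edge-coefficient {e = e} (fwd e _ p) e∉es pₑ≡0 = 1≢0 (begin
    1ℚ                                   ≡⟨ ℚ.+-identityʳ 1ℚ ⟨
    1ℚ + 0ℚ                              ≡⟨ cong₂ _+_ (δ-refl e) (walkCoefficient-∉ p e∉es) ⟨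
    δ e e + walkCoefficient p (edgeC e)  ≡⟨ pₑ≡0 ⟩
    0ℚ                                   ∎)
    where open ≡-Reasoning
  first-edge-coefficient {e = e} (bwd e _ p) e∉es pₑ≡0 = -1≢0 (begin
    - 1ℚ                                 ≡⟨ ℚ.+-identityˡ (- 1ℚ) ⟨
    0ℚ - 1ℚ                              ≡⟨ cong₂ _-_ (walkCoefficient-∉ p e∉es) (δ-refl e) ⟨
    walkCoefficient p (edgeC e) - δ e e  ≡⟨ pₑ≡0 ⟩
    0ℚ                                   ∎)
    where
    open ≡-Reasoning
    -1≢0 : - 1ℚ ≢ 0ℚ
    -1≢0 ()

  first-edge∈Ga : ∀ {u v e es} → UWalk E a u v (e ∷ es) → InGa a e
  first-edge∈Ga (fwd e e∈ _) = e∈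
  first-edge∈Ga (bwd e e∈ _) = e∈

  independent⇒forest : Injective _≡_ _≡_ a → LinearlyIndependent rows → Forest E a
  independent⇒forest inj indep v e es p (e∉es ∷ _) with first-edge∈Ga p
  ... | i , aᵢ≡e = first-edge-coefficient p e∉es (begin
    walkCoefficient p (edgeC e)  ≡⟨ cong (walkCoefficient p) aᵢ≡e ⟨
    walkCoefficient p (a i)      ≡⟨ indep (walkCoefficient p ∘ a) closed-walk i ⟩
    0ℚ                           ∎)
    where
    open ≡-Reasoning
    closed-walk : ∀ x → lincomb (walkCoefficient p ∘ a) rows x ≡ 0ℚ
    closed-walk x = trans (lincomb-walk inj p x) (ℚ.+-inverseʳ (δ v x))

  ·-row-edge : ∀ (z : Vector ℚ n) e → z · row E s t (edgeC e) ≡ z (hd E e) - z (tl E e)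
  ·-row-edge z e = begin
    ∑[ w < n ] (z w * (δ (hd E e) w - δ (tl E e) w))
      ≡⟨ sum-cong-≗ (λ w → solve 3 (λ z h t → z :* (h :- t) := z :* h :- z :* t)
                                   refl (z w) (δ (hd E e) w) (δ (tl E e) w)) ⟩
    ∑[ w < n ] (z w * δ (hd E e) w - z w * δ (tl E e) w)
      ≡⟨ ∑-distrib-− (λ w → z w * δ (hd E e) w) (λ w → z w * δ (tl E e) w) ⟩
    z · δ (hd E e) - z · δ (tl E e)
      ≡⟨ cong₂ _-_ (·-δ z (hd E e)) (·-δ z (tl E e)) ⟩
    z (hd E e) - z (tl E e)
      ∎
    where open ≡-Reasoning

  indicator-orthogonal : ∀ {p} → (∀ e → InGa a e → ¬ Leaving p e) → s ∉ p → t ∉ p →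
                         ∀ i → indicator p · rows i ≡ 0ℚ
  indicator-orthogonal {p} closed s∉p t∉p i with a i in aᵢ≡c
  ... | edgeC e = begin
    indicator p · row E s t (edgeC e)            ≡⟨ ·-row-edge (indicator p) e ⟩
    indicator p (hd E e) - indicator p (tl E e)  ≡⟨ cong (_- indicator p (tl E e)) tl≡hd ⟨
    indicator p (tl E e) - indicator p (tl E e)  ≡⟨ ℚ.+-inverseʳ (indicator p (tl E e)) ⟩
    0ℚ                                           ∎
    where
    open ≡-Reasoning
    tl≡hd = indicator-¬Leaving (closed e (i , aᵢ≡c))
  ... | srcC  = trans (·-δ (indicator p) s) (indicator-∉ s∉p)
  ... | sinkC = trans (·-δ (indicator p) t) (indicator-∉ t∉p)

connected-to-source-or-sink : ∀ {n m} (E : Edges n m) (s t : Fin n) (a : Fin n → Constraint m) →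
                              LinearlyIndependent (ConstraintRows.rows E s t a) →
                              let open ConstraintGraph E a in ∀ u → Connected u s ⊎ Connected u t
connected-to-source-or-sink E s t a indep u = decide (s ∈? members) (t ∈? members)
  where
  open ConstraintGraph E a
  open ConstraintRows E s t a
  open Component (component u)
  decide : Dec (s ∈ members) → Dec (t ∈ members) → Connected u s ⊎ Connected u t
  decide (yes s∈) _        = inj₁ (connected s∈)
  decide (no _)   (yes t∈) = inj₂ (connected t∈)
  decide (no s∉)  (no t∉)  = contradiction
    (orthogonal-dependent rows (indicator members) u (1≢0 ∘ trans (sym (indicator-∈ u∈members)))
                          (indicator-orthogonal closed s∉ t∉))
    (independent⇒¬dependent indep)

lemma5 : (n m : ℕ) (E : Edges n m) (s t : Fin n) → STDag n m E s t →
    (y : Fin n → ℚ) → InP E s t y →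
    (a : Fin n → Constraint m) → Injective _≡_ _≡_ a →
    ((i : Fin n) → Active E s t y (a i)) → LinIndep E s t a →
    TwoTrees E s t a
lemma5 n m E s t _ y (_ , y₀ , y₁) a inj active linIndep =
  side , side-s , side-t , side-edge ,
  equal-values-connected side side-edge (subst₂ _≢_ (sym side-s) (sym side-t) λ ())
                         (connected-to-source-or-sink E s t a indep) ,
  independent⇒forest inj indep
  where
  open ConstraintGraph E a
  open ConstraintRows E s t a
  indep : LinearlyIndependent rows
  indep = LinIndep⇒independent E s t a linIndep
  isOne : ℚ → Bool
  isOne q = does (q ℚ.≟ 1ℚ)
  side : Fin n → Bool
  side = isOne ∘ y
  side-s : side s ≡ false
  side-s = cong isOne y₀
  side-t : side t ≡ true
  side-t = cong isOne y₁
  side-edge : ∀ e → InGa a e → side (tl E e) ≡ side (hd E e)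
  side-edge e (i , aᵢ≡e) = cong isOne (subst (Active E s t y) aᵢ≡e (active i))
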